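{- For every $c>0$ and every $\delta>0$ there exist $\varepsilon>0$ and $n_0$ such that every graph $G$ on $n\ge n_0$ vertices with $\alpha(G)\ge cn$ and at most $2^{\varepsilon n}$ distinct maximum independent sets satisfies $h(G)\le\delta n$. (That is: if $G$ is an $n$-vertex graph with $\alpha(G)=\Omega(n)$ whose number of distinct maximum independent sets is $2^{o(n)}$, then $h(G)=o(n)$.)
   Context: All graphs are finite and simple. An independent set of $G$ is a set of pairwise non-adjacent vertices; a maximum independent set is one of largest possible size, and $\alpha(G)$ denotes this size. A hitting set of $G$ is a subset $T\subseteq V(G)$ with $T\cap I\neq\emptyset$ for every maximum independent set $I$ of $G$; $h(G)$ denotes the smallest size of a hitting set of $G$. -}

module Defs where

open import Data.Bool using (Bool; true; false; _∧_; not)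
open import Data.Nat using (ℕ; zero; suc; _⊔_; _⊓_; _≡ᵇ_)
open import Data.Fin using (Fin)
open import Data.Fin.Subset using (Subset; ∣_∣)
open import Data.Vec using (Vec; []; _∷_; lookup)
open import Data.List using (List; []; _∷_; map; _++_; foldr; filterᵇ; length; allFin)
open import Data.Bool.ListAction using (all; any)
open import Relation.Binary.PropositionalEquality using (_≡_)

record Graph (n : ℕ) : Set where
  field
    adj    : Fin n → Fin n → Bool
    sym    : ∀ i j → adj i j ≡ adj j i
    irrefl : ∀ i → adj i i ≡ false
open Graph public

subsets : (n : ℕ) → List (Subset n)
subsets zero    = [] ∷ []
subsets (suc n) = map (true ∷_) (subsets n) ++ map (false ∷_) (subsets n)

independent : ∀ {n} → Graph n → Subset n → Bool
independent {n} G I =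
  all (λ i → all (λ j → not (lookup I i ∧ lookup I j ∧ adj G i j)) (allFin n)) (allFin n)

α : ∀ {n} → Graph n → ℕ
α {n} G = foldr _⊔_ 0 (map ∣_∣ (filterᵇ (independent G) (subsets n)))

isMaxIndep : ∀ {n} → Graph n → Subset n → Bool
isMaxIndep G I = independent G I ∧ (∣ I ∣ ≡ᵇ α G)

maxIndepSets : ∀ {n} → Graph n → List (Subset n)
maxIndepSets {n} G = filterᵇ (isMaxIndep G) (subsets n)

numMaxIndep : ∀ {n} → Graph n → ℕ
numMaxIndep G = length (maxIndepSets G)

meets : ∀ {n} → Subset n → Subset n → Bool
meets {n} T I = any (λ i → lookup T i ∧ lookup I i) (allFin n)

hitting : ∀ {n} → Graph n → Subset n → Bool
hitting G T = all (meets T) (maxIndepSets G)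

-- h(G): minimum size of a hitting set (the fold starts at n, an upper
-- bound attained by the full vertex set whenever n ≥ 1).
h : ∀ {n} → Graph n → ℕ
h {n} G = foldr _⊓_ n (map ∣_∣ (filterᵇ (hitting G) (subsets n)))

{-# OPTIONS --safe #-}
-- Every maximum independent set I of G has n ≤ c ∣I∣ with c = b + 1, so by double counting
-- some vertex lies in at least a 1/c fraction of any family of maximum independent sets.
-- Greedily picking such vertices, within 2c picks at most half of the family is left unhit.
-- There are fewer than 2^j maximum independent sets for j = 1 + ⌊n/(k+1)⌋, so 2cj vertices
-- hit all of them, and 2cj ≤ δn once k + 1 is large compared with c/δ.
module Submission where

open import Defs hiding (sym)
open import Data.Bool using (true; false; T; if_then_else_)
open import Data.Bool.Properties using (T-∧; T-≡)
open import Data.Fin using (Fin; zero; suc)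
open import Data.Fin.Properties using (any?)
open import Data.Fin.Subset using (Subset; ∣_∣; ⋃; ⁅_⁆; _∪_) renaming (_∈_ to _∈ₛ_)
open import Data.Fin.Subset.Properties using (∣⊥∣≡0; ∣⁅x⁆∣≡1; x∈⁅x⁆; x∈p∪q⁺)
open import Data.List using (List; []; _∷_; _++_; length; filter; map)
open import Data.List.Properties using (length-++; foldr-preservesᵒ)
open import Data.List.Membership.Propositional using (_∈_; lose; find)
open import Data.List.Membership.Propositional.Properties
  using (∈-filter⁺; ∈-filter⁻; ∈-map⁺; ∈-++⁺ˡ; ∈-++⁺ʳ; ∈-allFin)
open import Data.List.Relation.Unary.All as All using (All; []; _∷_)
open import Data.List.Relation.Unary.All.Properties using (filter⁺; all⁻)
open import Data.List.Relation.Unary.Any using (Any; here; there)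
open import Data.List.Relation.Unary.Any.Properties using (any⁺)
open import Data.Nat
open import Data.Nat.DivMod using (_/_; _%_; m≡m%n+[m/n]*n; m%n<n; m/n*n≤m)
open import Data.Nat.ListAction using (sum)
open import Data.Nat.Properties
open import Algebra.Properties.CommutativeSemigroup *-commutativeSemigroup using (x∙yz≈y∙xz)
open import Algebra.Properties.Semiring.Sum +-*-semiring
  using (sum-syntax; sum-replicate-zero; sum-cong-≗; ∑-distrib-+; *-distribˡ-sum)
open import Data.Product using (∃-syntax; _×_; _,_; proj₂)
open import Data.Sum using (inj₁; inj₂; [_,_]′)
open import Data.Vec using (lookup; []; _∷_)
open import Data.Vec.Properties using ([]=⇒lookup)
open import Function using (_∘_; Equivalence)
open import Relation.Binary.PropositionalEquality
open import Relation.Nullary using (yes; no; T?; contradiction)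
open import Relation.Unary using (Pred; Decidable)
open import Relation.Unary.Properties using (∁?)

length-filter-∁ : ∀ {a p} {A : Set a} {P : Pred A p} (P? : Decidable P) (xs : List A) →
                  length (filter (∁? P?) xs) + length (filter P? xs) ≡ length xs
length-filter-∁ P? []       = refl
length-filter-∁ P? (x ∷ xs) with P? x
... | yes _ = trans (+-suc _ _) (cong suc (length-filter-∁ P? xs))
... | no  _ = cong suc (length-filter-∁ P? xs)

∑<n*m : ∀ {n m} (f : Fin (suc n) → ℕ) → (∀ i → f i < m) → ∑[ i < suc n ] f i < suc n * m
∑<n*m {zero}  {m} f f<m = subst₂ _<_ (sym (+-identityʳ _)) (sym (*-identityˡ m)) (f<m zero)
∑<n*m {suc n}     f f<m = +-mono-< (f<m zero) (∑<n*m (f ∘ suc) (f<m ∘ suc))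

∣p∪q∣≤∣p∣+∣q∣ : ∀ {n} (p q : Subset n) → ∣ p ∪ q ∣ ≤ ∣ p ∣ + ∣ q ∣
∣p∪q∣≤∣p∣+∣q∣ []          []          = z≤n
∣p∪q∣≤∣p∣+∣q∣ (true ∷ p)  (true ∷ q)  = s≤s (≤-trans (∣p∪q∣≤∣p∣+∣q∣ p q) (+-monoʳ-≤ ∣ p ∣ (n≤1+n ∣ q ∣)))
∣p∪q∣≤∣p∣+∣q∣ (true ∷ p)  (false ∷ q) = s≤s (∣p∪q∣≤∣p∣+∣q∣ p q)
∣p∪q∣≤∣p∣+∣q∣ (false ∷ p) (true ∷ q)  = ≤-trans (s≤s (∣p∪q∣≤∣p∣+∣q∣ p q)) (≤-reflexive (sym (+-suc ∣ p ∣ ∣ q ∣)))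
∣p∪q∣≤∣p∣+∣q∣ (false ∷ p) (false ∷ q) = ∣p∪q∣≤∣p∣+∣q∣ p q

∣⋃⁅L⁆∣≤length : ∀ {n} (L : List (Fin n)) → ∣ ⋃ (map ⁅_⁆ L) ∣ ≤ length L
∣⋃⁅L⁆∣≤length {n} []      = ≤-reflexive (∣⊥∣≡0 n)
∣⋃⁅L⁆∣≤length     (v ∷ L) =
  ≤-trans (∣p∪q∣≤∣p∣+∣q∣ ⁅ v ⁆ _) (+-mono-≤ (≤-reflexive (∣⁅x⁆∣≡1 v)) (∣⋃⁅L⁆∣≤length L))

x∈L⇒x∈⋃⁅L⁆ : ∀ {n} {v : Fin n} {L} → v ∈ L → v ∈ₛ ⋃ (map ⁅_⁆ L)
x∈L⇒x∈⋃⁅L⁆ (here refl) = x∈p∪q⁺ (inj₁ (x∈⁅x⁆ _))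
x∈L⇒x∈⋃⁅L⁆ (there v∈L) = x∈p∪q⁺ (inj₂ (x∈L⇒x∈⋃⁅L⁆ v∈L))

module _ {n : ℕ} where

  contains? : (v : Fin n) → Decidable (λ (I : Subset n) → T (lookup I v))
  contains? v I = T? (lookup I v)

  degree : Fin n → List (Subset n) → ℕ
  degree v F = length (filter (contains? v) F)

  avoiding : Fin n → List (Subset n) → List (Subset n)
  avoiding v = filter (∁? (contains? v))

  avoidingAll : List (Fin n) → List (Subset n) → List (Subset n)
  avoidingAll []      F = F
  avoidingAll (v ∷ L) F = avoidingAll L (avoiding v F)

  Large : ℕ → Subset n → Set
  Large c I = n ≤ c * ∣ I ∣

degree-∷ : ∀ {n} (v : Fin n) I F → degree v (I ∷ F) ≡ (if lookup I v then 1 else 0) + degree v F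
degree-∷ v I F with lookup I v
... | true  = refl
... | false = refl

∑-indicator≡∣I∣ : ∀ {n} (I : Subset n) → ∑[ v < n ] (if lookup I v then 1 else 0) ≡ ∣ I ∣
∑-indicator≡∣I∣ []          = refl
∑-indicator≡∣I∣ (true ∷ I)  = cong suc (∑-indicator≡∣I∣ I)
∑-indicator≡∣I∣ (false ∷ I) = ∑-indicator≡∣I∣ I

∑-degree : ∀ {n} (F : List (Subset n)) → ∑[ v < n ] degree v F ≡ sum (map ∣_∣ F)
∑-degree {n} []      = sum-replicate-zero n
∑-degree {n} (I ∷ F) = begin
  ∑[ v < n ] degree v (I ∷ F)                ≡⟨ sum-cong-≗ (λ v → degree-∷ v I F) ⟩
  ∑[ v < n ] (𝟙 v + degree v F)              ≡⟨ ∑-distrib-+ 𝟙 (λ v → degree v F) ⟩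
  ∑[ v < n ] 𝟙 v + ∑[ v < n ] degree v F     ≡⟨ cong₂ _+_ (∑-indicator≡∣I∣ I) (∑-degree F) ⟩
  ∣ I ∣ + sum (map ∣_∣ F)                    ∎
  where
  open ≡-Reasoning
  𝟙 : Fin n → ℕ
  𝟙 v = if lookup I v then 1 else 0

length*n≤c*∑∣I∣ : ∀ {n} c (F : List (Subset n)) → All (Large c) F → length F * n ≤ c * sum (map ∣_∣ F)
length*n≤c*∑∣I∣     c []      []               = z≤n
length*n≤c*∑∣I∣ {n} c (I ∷ F) (large ∷ larges) = begin
  n + length F * n                ≤⟨ +-mono-≤ large (length*n≤c*∑∣I∣ c F larges) ⟩
  c * ∣ I ∣ + c * sum (map ∣_∣ F) ≡⟨ *-distribˡ-+ c ∣ I ∣ _ ⟨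
  c * sum (map ∣_∣ (I ∷ F))       ∎
  where open ≤-Reasoning

popular-vertex : ∀ {n} c (F : List (Subset (suc n))) → All (Large c) F → ∃[ v ] length F ≤ c * degree v F
popular-vertex {n} c F larges with any? (λ v → length F ≤? c * degree v F)
... | yes found = found
... | no  none  = contradiction (length*n≤c*∑∣I∣ c F larges) (<⇒≱ c*∑∣I∣<length*n)
  where
  open ≤-Reasoning
  c*∑∣I∣<length*n : c * sum (map ∣_∣ F) < length F * suc n
  c*∑∣I∣<length*n = begin-strict
    c * sum (map ∣_∣ F)              ≡⟨ cong (c *_) (∑-degree F) ⟨
    c * (∑[ v < suc n ] degree v F)  ≡⟨ *-distribˡ-sum c (λ v → degree v F) ⟩
    ∑[ v < suc n ] (c * degree v F)  <⟨ ∑<n*m (λ v → c * degree v F) (λ v → ≰⇒> (λ found → none (v , found))) ⟩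
    suc n * length F                 ≡⟨ *-comm (suc n) (length F) ⟩
    length F * suc n                 ∎

avoidingAll-++ : ∀ {n} (L L′ : List (Fin n)) F → avoidingAll (L ++ L′) F ≡ avoidingAll L′ (avoidingAll L F)
avoidingAll-++ []      L′ F = refl
avoidingAll-++ (v ∷ L) L′ F = avoidingAll-++ L L′ (avoiding v F)

avoidingAll⁺ : ∀ {n p} {P : Pred (Subset n) p} L {F} → All P F → All P (avoidingAll L F)
avoidingAll⁺ []      ps = ps
avoidingAll⁺ (v ∷ L) ps = avoidingAll⁺ L (filter⁺ (∁? (contains? v)) ps)

avoidingAll≡[]⇒Any : ∀ {n} (L : List (Fin n)) {F I} → avoidingAll L F ≡ [] → I ∈ F → Any (λ v → T (lookup I v)) L
avoidingAll≡[]⇒Any []      refl ()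
avoidingAll≡[]⇒Any (v ∷ L) {I = I} emptied I∈F with contains? v I
... | yes I∋v = here I∋v
... | no  I∌v = there (avoidingAll≡[]⇒Any L emptied (∈-filter⁺ (∁? (contains? v)) I∈F I∌v))

-- While F is not yet halved (N ≤ 2∣F∣), a popular vertex lies in at least N/(2c) of its sets.
avoiding-popular : ∀ {n} c (v : Fin n) F N s → length F ≤ c * degree v F → N ≤ 2 * length F →
                   c * (2 * length F) ≤ suc s * N → c * (2 * length (avoiding v F)) ≤ s * N
avoiding-popular c v F N s popular N≤2∣F∣ bound = +-cancelˡ-≤ N _ _ (begin
  N + c * (2 * a)               ≤⟨ +-monoˡ-≤ _ N≤c*2d ⟩
  c * (2 * d) + c * (2 * a)     ≡⟨ *-distribˡ-+ c (2 * d) (2 * a) ⟨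
  c * (2 * d + 2 * a)           ≡⟨ cong (c *_) (*-distribˡ-+ 2 d a) ⟨
  c * (2 * (d + a))             ≡⟨ cong (λ x → c * (2 * x)) (trans (+-comm d a) (length-filter-∁ (contains? v) F)) ⟩
  c * (2 * length F)            ≤⟨ bound ⟩
  N + s * N                     ∎)
  where
  open ≤-Reasoning
  a = length (avoiding v F)
  d = degree v F
  N≤c*2d : N ≤ c * (2 * d)
  N≤c*2d = begin
    N               ≤⟨ N≤2∣F∣ ⟩
    2 * length F    ≤⟨ *-monoʳ-≤ 2 popular ⟩
    2 * (c * d)     ≡⟨ x∙yz≈y∙xz 2 c d ⟩
    c * (2 * d)     ∎

shrinking : ∀ {n} c .{{_ : NonZero c}} N s (F : List (Subset (suc n))) → All (Large c) F →
            c * (2 * length F) ≤ s * N → ∃[ L ] length L ≤ s × 2 * length (avoidingAll L F) ≤ N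
shrinking c N zero F _ bound =
  [] , z≤n , ≤-trans (*-cancelˡ-≤ c (≤-trans bound (≤-reflexive (sym (*-zeroʳ c))))) z≤n
shrinking c N (suc s) F larges bound with 2 * length F ≤? N
... | yes halved = [] , z≤n , halved
... | no ¬halved =
  let v , popular = popular-vertex c F larges
      L , ∣L∣≤s , halved = shrinking c N s (avoiding v F) (filter⁺ (∁? (contains? v)) larges)
                             (avoiding-popular c v F N s popular (<⇒≤ (≰⇒> ¬halved)) bound)
  in  v ∷ L , s≤s ∣L∣≤s , halved

halving : ∀ {n} c .{{_ : NonZero c}} (F : List (Subset (suc n))) → All (Large c) F →
          ∃[ L ] length L ≤ 2 * c × 2 * length (avoidingAll L F) ≤ length F
halving c F larges =
  shrinking c (length F) (2 * c) F larges (≤-reflexive (trans (x∙yz≈y∙xz c 2 _) (sym (*-assoc 2 c _))))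

hittingVertices : ∀ {n} c .{{_ : NonZero c}} j (F : List (Subset (suc n))) → All (Large c) F →
                  length F < 2 ^ j → ∃[ L ] length L ≤ 2 * c * j × avoidingAll L F ≡ []
hittingVertices c zero    []      _ _ = [] , z≤n , refl
hittingVertices c zero    (_ ∷ _) _ (s≤s ())
hittingVertices c (suc j) F larges ∣F∣<2^[1+j] =
  let L , ∣L∣≤2c , halved = halving c F larges
      L′ , ∣L′∣≤2cj , emptied = hittingVertices c j (avoidingAll L F) (avoidingAll⁺ L larges)
                                  (*-cancelˡ-< 2 _ _ (≤-<-trans halved ∣F∣<2^[1+j]))
  in  L ++ L′ , ∣L++L′∣≤2c[1+j] L L′ ∣L∣≤2c ∣L′∣≤2cj , trans (avoidingAll-++ L L′ F) emptied
  where
  ∣L++L′∣≤2c[1+j] : ∀ {A : Set} (L L′ : List A) → length L ≤ 2 * c → length L′ ≤ 2 * c * j →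
                     length (L ++ L′) ≤ 2 * c * suc j
  ∣L++L′∣≤2c[1+j] L L′ ∣L∣≤2c ∣L′∣≤2cj = begin
    length (L ++ L′)        ≡⟨ length-++ L ⟩
    length L + length L′    ≤⟨ +-mono-≤ ∣L∣≤2c ∣L′∣≤2cj ⟩
    2 * c + 2 * c * j       ≡⟨ *-suc (2 * c) j ⟨
    2 * c * suc j           ∎
    where open ≤-Reasoning

meets⁺ : ∀ {n} {S I : Subset n} v → v ∈ₛ S → T (lookup I v) → T (meets S I)
meets⁺ v v∈S I∋v =
  any⁺ _ (lose (∈-allFin v) (Equivalence.from T-∧ (Equivalence.from T-≡ ([]=⇒lookup v∈S) , I∋v)))

∈-subsets : ∀ {n} (S : Subset n) → S ∈ subsets n
∈-subsets []                  = here refl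
∈-subsets         (true ∷ S)  = ∈-++⁺ˡ (∈-map⁺ (true ∷_) (∈-subsets S))
∈-subsets {suc n} (false ∷ S) = ∈-++⁺ʳ (map (true ∷_) (subsets n)) (∈-map⁺ (false ∷_) (∈-subsets S))

h≤∣hitting∣ : ∀ {n} (G : Graph n) S → T (hitting G S) → h G ≤ ∣ S ∣
h≤∣hitting∣ {n} G S hits =
  foldr-preservesᵒ {P = _≤ ∣ S ∣} {f = _⊓_} (λ x y → [ m≤n⇒m⊓o≤n y , m≤n⇒o⊓m≤n x ]′) n _
  (inj₂ (lose (∈-map⁺ ∣_∣ (∈-filter⁺ (T? ∘ hitting G) (∈-subsets S) hits)) ≤-refl))

∣maxIndep∣≡α : ∀ {n} (G : Graph n) {I} → I ∈ maxIndepSets G → ∣ I ∣ ≡ α G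
∣maxIndep∣≡α {n} G {I} I∈F =
  ≡ᵇ⇒≡ ∣ I ∣ (α G) (proj₂ (Equivalence.to T-∧ (proj₂ (∈-filter⁻ (T? ∘ isMaxIndep G) {xs = subsets n} I∈F))))

maxIndepSets-Large : ∀ {n} (G : Graph n) c → n ≤ c * α G → All (Large c) (maxIndepSets G)
maxIndepSets-Large G c n≤cα =
  All.tabulate λ I∈F → ≤-trans n≤cα (≤-reflexive (cong (c *_) (sym (∣maxIndep∣≡α G I∈F))))

⋃⁅L⁆-hitting : ∀ {n} (G : Graph n) L → avoidingAll L (maxIndepSets G) ≡ [] → T (hitting G (⋃ (map ⁅_⁆ L)))
⋃⁅L⁆-hitting G L emptied = all⁻ (meets (⋃ (map ⁅_⁆ L))) (All.tabulate λ {I} I∈F →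
  let v , v∈L , I∋v = find (avoidingAll≡[]⇒Any L emptied I∈F)
  in  meets⁺ {I = I} v (x∈L⇒x∈⋃⁅L⁆ v∈L) I∋v)

h≤2cj : ∀ {n} c .{{_ : NonZero c}} j (G : Graph (suc n)) → suc n ≤ c * α G → numMaxIndep G < 2 ^ j →
        h G ≤ 2 * c * j
h≤2cj c j G n≤cα few =
  let L , ∣L∣≤2cj , emptied = hittingVertices c j (maxIndepSets G) (maxIndepSets-Large G c n≤cα) few
  in  ≤-trans (h≤∣hitting∣ G (⋃ (map ⁅_⁆ L)) (⋃⁅L⁆-hitting G L emptied)) (≤-trans (∣⋃⁅L⁆∣≤length L) ∣L∣≤2cj)

n<[1+n/m]*m : ∀ n m .{{_ : NonZero m}} → n < suc (n / m) * m
n<[1+n/m]*m n m = begin-strict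
  n                 ≡⟨ m≡m%n+[m/n]*n n m ⟩
  n % m + n / m * m <⟨ +-monoˡ-< _ (m%n<n n m) ⟩
  m + n / m * m     ∎
  where open ≤-Reasoning

x^m≤2^n⇒x<2^j : ∀ {x m n} j → x ^ m ≤ 2 ^ n → n < j * m → x < 2 ^ j
x^m≤2^n⇒x<2^j {x} {m} {n} j x^m≤2^n n<jm = ≰⇒> λ 2^j≤x → <⇒≱ (^-monoʳ-< 2 (n<1+n 1) n<jm) (begin
  2 ^ (j * m) ≡⟨ ^-*-assoc 2 j m ⟨
  (2 ^ j) ^ m ≤⟨ ^-monoˡ-≤ m 2^j≤x ⟩
  x ^ m       ≤⟨ x^m≤2^n ⟩
  2 ^ n       ∎)
  where open ≤-Reasoning

d*[1+n/[1+2d]]≤n : ∀ d n → suc (2 * d) ≤ n → d * suc (n / suc (2 * d)) ≤ n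
d*[1+n/[1+2d]]≤n d n 1+2d≤n = *-cancelˡ-≤ 2 (begin
  2 * (d * suc q)      ≡⟨ cong (2 *_) (*-suc d q) ⟩
  2 * (d + d * q)      ≡⟨ *-distribˡ-+ 2 d (d * q) ⟩
  2 * d + 2 * (d * q)  ≡⟨ cong (2 * d +_) (*-assoc 2 d q) ⟨
  2 * d + 2 * d * q    ≤⟨ +-mono-≤ (≤-trans (n≤1+n _) 1+2d≤n) 2dq≤n ⟩
  n + n                ≡⟨ cong (n +_) (+-identityʳ n) ⟨
  2 * n                ∎)
  where
  open ≤-Reasoning
  q = n / suc (2 * d)
  2dq≤n : 2 * d * q ≤ n
  2dq≤n = begin
    2 * d * q          ≡⟨ *-comm (2 * d) q ⟩
    q * (2 * d)        ≤⟨ *-monoʳ-≤ q (n≤1+n _) ⟩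
    q * suc (2 * d)    ≤⟨ m/n*n≤m n (suc (2 * d)) ⟩
    n                  ∎

theorem3 : ∀ (a b d e : ℕ) → ∃[ k ] ∃[ n₀ ] (∀ (n : ℕ) → n₀ ≤ n → (G : Graph n)
    → suc a * n ≤ suc b * α G
    → numMaxIndep G ^ suc k ≤ 2 ^ n
    → suc e * h G ≤ suc d * n)
theorem3 a b d e = k , suc k , bound
  where
  D = suc e * (2 * suc b)
  k = 2 * D
  bound : ∀ n → suc k ≤ n → (G : Graph n) → suc a * n ≤ suc b * α G → numMaxIndep G ^ suc k ≤ 2 ^ n →
          suc e * h G ≤ suc d * n
  bound n@(suc _) k<n G α-large few = begin
    suc e * h G               ≤⟨ *-monoʳ-≤ (suc e) (h≤2cj (suc b) j G dense fewer) ⟩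
    suc e * (2 * suc b * j)   ≡⟨ *-assoc (suc e) (2 * suc b) j ⟨
    D * j                     ≤⟨ d*[1+n/[1+2d]]≤n D n k<n ⟩
    n                         ≤⟨ m≤n*m n (suc d) ⟩
    suc d * n                 ∎
    where
    open ≤-Reasoning
    j = suc (n / suc k)
    dense : n ≤ suc b * α G
    dense = ≤-trans (m≤n*m n (suc a)) α-large
    fewer : numMaxIndep G < 2 ^ j
    fewer = x^m≤2^n⇒x<2^j j few (n<[1+n/m]*m n (suc k))
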